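{- Let $r>0$, let $\tau=(3,1,2)$ or $\tau=(3,2,1)$, and let $\rho\in\mathcal S_n$ be a permutation containing exactly $r$ occurrences of $\tau$. Then $\psi_\tau(\rho)\in\bigcup_{s=1}^{r}D_{n,s}$; i.e., $\psi_\tau$ maps a permutation with exactly $r$ occurrences of $\tau$ to a Dyck path with at least one and at most $r$ down-jumps.
   Context: For a permutation $\rho=(\rho_1,\dots,\rho_n)$ of $\{1,\dots,n\}$ and $\tau\in\mathcal S_3$, an occurrence of $\tau$ in $\rho$ is a subword $(\rho_a,\rho_b,\rho_c)$, $a<b<c$, in the same relative order as $\tau$ (for $(3,1,2)$: $\rho_b<\rho_c<\rho_a$; for $(3,2,1)$: $\rho_c<\rho_b<\rho_a$). An entry $\rho_i$ is a left-to-right maximum if $\rho_i>\rho_j$ for all $j<i$; the preceding left-to-right maximum of position $i$ is $\rho_r$ with $r\le i$ maximal such that $\rho_r$ is a left-to-right maximum. Height vector: for $\tau=(3,1,2)$, $h_i=\#\{k>i:\rho_k<\rho_i\}$. For $\tau=(3,2,1)$: if $\rho_i$ is a left-to-right maximum, $h_i=\#\{k>i:\rho_k<\rho_i\}$; otherwise $h_i=\#\{k>i:\rho_i<\rho_k<\rho_r\}$ with $\rho_r$ the preceding left-to-right maximum of position $i$. The path $\psi_\tau(\rho)$ uses up-steps $(1,1)$, down-steps $(1,-1)$ and down-jumps $(0,-1)$: start at $(0,0)$; for $i=1,\dots,n$, if the current endpoint is below height $h_i+1$ append up-steps until height $h_i+1$ is reached, otherwise append down-jumps until height $h_i+1$ is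 reached; then append one down-step. $D_{n,s}$ denotes the set of lattice paths from $(0,0)$ to $(2n+s,0)$ consisting of $n+s$ up-steps, $n$ down-steps and $s$ down-jumps that never go below the horizontal axis. -}

module Defs where

open import Data.Nat using (ℕ; zero; suc; _+_; _∸_; _<ᵇ_; _≤ᵇ_; _<?_)
open import Relation.Nullary using (yes; no)
open import Relation.Nullary.Decidable.Core using (T?)
open import Data.Bool using (Bool; true; false; _∧_; if_then_else_)
open import Data.Fin using (Fin; toℕ; fromℕ<)
open import Data.Fin.Permutation using (Permutation′; _⟨$⟩ʳ_)
open import Data.List using (List; []; _∷_; _++_; upTo; map; replicate; filter; length)
open import Data.Nat.ListAction using (sum)
open import Data.Bool.ListAction using (all)
open import Data.Unit using (⊤)
open import Data.Empty using (⊥)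
open import Relation.Binary.PropositionalEquality using (_≡_)
open import Data.Product using (_×_)

data Pattern : Set where
  p312 p321 : Pattern

-- A permutation ρ ∈ S_n, read as a function of 0-based positions to
-- 0-based values (value toℕ (ρ ⟨$⟩ʳ i) stands for ρ_{i+1} - 1);
-- positions ≥ n are mapped to 0 and never consulted.
val : {n : ℕ} → Permutation′ n → ℕ → ℕ
val {n} ρ i with i <? n
... | yes p = toℕ (ρ ⟨$⟩ʳ fromℕ< p)
... | no _ = 0

indicator : Bool → ℕ
indicator true = 1
indicator false = 0

inOrder : Pattern → ℕ → ℕ → ℕ → Bool
inOrder p312 x y z = (y <ᵇ z) ∧ (z <ᵇ x)
inOrder p321 x y z = (z <ᵇ y) ∧ (y <ᵇ x)

occurrences : {n : ℕ} → Pattern → Permutation′ n → ℕ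
occurrences {n} τ ρ =
  sum (map (λ a → sum (map (λ b → sum (map (λ c →
    indicator ((a <ᵇ b) ∧ (b <ᵇ c) ∧ inOrder τ (val ρ a) (val ρ b) (val ρ c)))
    (upTo n))) (upTo n))) (upTo n))

countAfter : {n : ℕ} → Permutation′ n → ℕ → (ℕ → Bool) → ℕ
countAfter {n} ρ i P = sum (map (λ k → indicator ((i <ᵇ k) ∧ P (val ρ k))) (upTo n))

isLRmax : {n : ℕ} → Permutation′ n → ℕ → Bool
isLRmax ρ i = all (λ j → val ρ j <ᵇ val ρ i) (upTo i)

precLRmax : {n : ℕ} → Permutation′ n → ℕ → ℕ
precLRmax ρ zero = zero
precLRmax ρ (suc i) = if isLRmax ρ (suc i) then suc i else precLRmax ρ i

height : {n : ℕ} → Pattern → Permutation′ n → ℕ → ℕ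
height p312 ρ i = countAfter ρ i (λ x → x <ᵇ val ρ i)
height p321 ρ i =
  if isLRmax ρ i
  then countAfter ρ i (λ x → x <ᵇ val ρ i)
  else countAfter ρ i (λ x → (val ρ i <ᵇ x) ∧ (x <ᵇ val ρ (precLRmax ρ i)))

data Step : Set where
  up down jump : Step   -- (1,1), (1,-1), (0,-1)

buildPath : ℕ → List ℕ → List Step
buildPath cur [] = []
buildPath cur (h ∷ hs) =
  (if cur ≤ᵇ suc h
   then replicate (suc h ∸ cur) up
   else replicate (cur ∸ suc h) jump)
  ++ (down ∷ buildPath h hs)

ψ : {n : ℕ} → Pattern → Permutation′ n → List Step
ψ {n} τ ρ = buildPath 0 (map (height τ ρ) (upTo n))

NeverBelow : ℕ → List Step → Set
NeverBelow h [] = ⊤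
NeverBelow h (up ∷ p) = NeverBelow (suc h) p
NeverBelow zero (down ∷ p) = ⊥
NeverBelow (suc h) (down ∷ p) = NeverBelow h p
NeverBelow zero (jump ∷ p) = ⊥
NeverBelow (suc h) (jump ∷ p) = NeverBelow h p

isUp isDown isJump : Step → Bool
isUp up = true
isUp _ = false
isDown down = true
isDown _ = false
isJump jump = true
isJump _ = false

numSteps : (Step → Bool) → List Step → ℕ
numSteps P p = length (filter (λ s → T? (P s)) p)

-- membership in D_{n,s}: n+s up-steps, n down-steps, s down-jumps, never below axis
-- (starting at (0,0), these counts force the endpoint (2n+s, 0))
InD : ℕ → ℕ → List Step → Set
InD n s p = (numSteps isUp p ≡ n + s) × (numSteps isDown p ≡ n)
          × (numSteps isJump p ≡ s) × NeverBelow 0 p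

{-# OPTIONS --safe #-}
-- Write h_0, …, h_(n-1) for the height vector (positions are 0-based). The path ψ_τ(ρ)
-- climbs to h_j + 1 and takes one down-step per position, so it has n down-steps, never
-- goes below the axis, ends at height h_(n-1) = 0, and has Σ_j max(0, h_j - h_(j+1) - 1)
-- down-jumps; the up-steps then balance automatically.
--
-- Every k > j counted by h_j is j + 1, or is counted by h_(j+1), or is the last entry of
-- an occurrence (a, j+1, k) of τ, where a = j for 312 and a is the preceding
-- left-to-right maximum of j for 321. So the jumps in front of the down-step of j + 1
-- are bounded by the occurrences with middle entry j + 1, and there are at most r jumps.
-- Conversely, below an occurrence (a, b, c) a discrete intermediate value argument finds
-- a j < b with h_j ≥ h_(j+1) + 2: for 312 the last j in [a, b) with ρ_j > ρ_c, for 321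
-- the last j in [0, b) that is a left-to-right maximum or has ρ_j < ρ_c.
module Submission where

open import Defs
open import Algebra.Properties.CommutativeSemigroup using (interchange)
open import Data.Bool using (Bool; true; false; T; _∧_; if_then_else_)
open import Data.Bool.Properties using (T-∧)
open import Data.Empty using (⊥-elim)
open import Data.Fin using (toℕ; fromℕ<)
open import Data.Fin.Permutation using (Permutation′; _⟨$⟩ʳ_)
open import Data.Fin.Properties using (toℕ-injective; fromℕ<-injective)
open import Data.List using (List; []; _∷_; _++_; applyUpTo; map; upTo; replicate; filter; length)
open import Data.List.Membership.Propositional using (find)
open import Data.List.Membership.Propositional.Properties using (∈-upTo⁺; ∈-upTo⁻)
open import Data.List.Properties using (length-++; filter-++; map-upTo; length-applyUpTo)
open import Data.List.Relation.Unary.All using (lookup)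
open import Data.List.Relation.Unary.All.Properties using (all⁺; all⁻; ¬All⇒Any¬)
open import Data.Nat
open import Data.Nat.ListAction using (sum)
open import Data.Nat.Properties
open import Data.Nat.Solver using (module +-*-Solver)
open import Data.Product using (∃; _×_; _,_; proj₁; proj₂)
open import Data.Sum using (_⊎_; inj₁; inj₂; [_,_]′)
open import Data.Unit using (tt)
open import Function using (_∘_; _$_; id; Equivalence)
open import Function.Bundles using (Injection)
open import Function.Properties.Inverse using (↔⇒↣)
open import Relation.Binary using (tri<; tri≈; tri>)
open import Relation.Binary.PropositionalEquality
  using (_≡_; _≢_; refl; sym; trans; cong; cong₂; subst; subst₂; module ≡-Reasoning)
open import Relation.Nullary using (¬_; Dec; yes; no)
open import Relation.Nullary.Decidable.Core using (T?; _⊎-dec_)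
open import Relation.Unary using (Decidable)

-- Finite sums and counting

sumBelow : (ℕ → ℕ) → ℕ → ℕ
sumBelow g zero = 0
sumBelow g (suc n) = g 0 + sumBelow (g ∘ suc) n

sum-applyUpTo : ∀ (g h : ℕ → ℕ) n → sum (map g (applyUpTo h n)) ≡ sumBelow (g ∘ h) n
sum-applyUpTo g h zero = refl
sum-applyUpTo g h (suc n) = cong (g (h 0) +_) (sum-applyUpTo g (h ∘ suc) n)

sum-upTo : ∀ (g : ℕ → ℕ) n → sum (map g (upTo n)) ≡ sumBelow g n
sum-upTo g = sum-applyUpTo g id

sumBelow-cong : ∀ {g h : ℕ → ℕ} n → (∀ k → k < n → g k ≡ h k) → sumBelow g n ≡ sumBelow h n
sumBelow-cong zero e = refl
sumBelow-cong (suc n) e = cong₂ _+_ (e 0 z<s) (sumBelow-cong n (λ k k<n → e (suc k) (s<s k<n)))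

sumBelow-mono : ∀ {g h : ℕ → ℕ} n → (∀ k → k < n → g k ≤ h k) → sumBelow g n ≤ sumBelow h n
sumBelow-mono zero le = z≤n
sumBelow-mono (suc n) le = +-mono-≤ (le 0 z<s) (sumBelow-mono n (λ k k<n → le (suc k) (s<s k<n)))

sumBelow-mono-< : ∀ {g h : ℕ → ℕ} n x → (∀ k → k < n → g k ≤ h k) → x < n → g x < h x
  → sumBelow g n < sumBelow h n
sumBelow-mono-< (suc n) zero le _ lt = +-mono-<-≤ lt (sumBelow-mono n (λ k k<n → le (suc k) (s<s k<n)))
sumBelow-mono-< (suc n) (suc x) le (s<s x<n) lt =
  +-mono-≤-< (le 0 z<s) (sumBelow-mono-< n x (λ k k<n → le (suc k) (s<s k<n)) x<n lt)

sumBelow-mono-<₂ : ∀ {g h : ℕ → ℕ} n x y → (∀ k → k < n → g k ≤ h k) → x < n → y < n → x ≢ y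
  → g x < h x → g y < h y → 2 + sumBelow g n ≤ sumBelow h n
sumBelow-mono-<₂ (suc n) zero zero _ _ _ x≢y _ _ = ⊥-elim (x≢y refl)
sumBelow-mono-<₂ {g} (suc n) zero (suc y) le _ (s<s y<n) _ ltx lty =
  ≤-trans (≤-reflexive (cong suc (sym (+-suc (g 0) _))))
    (+-mono-≤ ltx (sumBelow-mono-< n y (λ k k<n → le (suc k) (s<s k<n)) y<n lty))
sumBelow-mono-<₂ {g} (suc n) (suc x) zero le (s<s x<n) _ _ ltx lty =
  ≤-trans (≤-reflexive (cong suc (sym (+-suc (g 0) _))))
    (+-mono-≤ lty (sumBelow-mono-< n x (λ k k<n → le (suc k) (s<s k<n)) x<n ltx))
sumBelow-mono-<₂ {g} (suc n) (suc x) (suc y) le (s<s x<n) (s<s y<n) x≢y ltx lty =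
  ≤-trans (≤-reflexive (sym (trans (+-suc (g 0) _) (cong suc (+-suc (g 0) _)))))
    (+-mono-≤ (le 0 z<s)
      (sumBelow-mono-<₂ n x y (λ k k<n → le (suc k) (s<s k<n)) x<n y<n (x≢y ∘ cong suc) ltx lty))

sumBelow-+ : ∀ (g h : ℕ → ℕ) n → sumBelow (λ k → g k + h k) n ≡ sumBelow g n + sumBelow h n
sumBelow-+ g h zero = refl
sumBelow-+ g h (suc n) = trans (cong (g 0 + h 0 +_) (sumBelow-+ (g ∘ suc) (h ∘ suc) n))
  (interchange +-commutativeSemigroup (g 0) (h 0) _ _)

sumBelow-null : ∀ (g : ℕ → ℕ) n → (∀ k → k < n → g k ≡ 0) → sumBelow g n ≡ 0
sumBelow-null g zero _ = refl
sumBelow-null g (suc n) null =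
  cong₂ _+_ (null 0 z<s) (sumBelow-null (g ∘ suc) n (λ k k<n → null (suc k) (s<s k<n)))

sumBelow-swap : ∀ (g : ℕ → ℕ → ℕ) n m
  → sumBelow (λ a → sumBelow (g a) m) n ≡ sumBelow (λ b → sumBelow (λ a → g a b) n) m
sumBelow-swap g zero m = sym (sumBelow-null (λ _ → 0) m (λ _ _ → refl))
sumBelow-swap g (suc n) m = begin
  sumBelow (g 0) m + sumBelow (λ a → sumBelow (g (suc a)) m) n
    ≡⟨ cong (sumBelow (g 0) m +_) (sumBelow-swap (g ∘ suc) n m) ⟩
  sumBelow (g 0) m + sumBelow (λ b → sumBelow (λ a → g (suc a) b) n) m
    ≡⟨ sym (sumBelow-+ (g 0) (λ b → sumBelow (λ a → g (suc a) b) n) m) ⟩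
  sumBelow (λ b → sumBelow (λ a → g a b) (suc n)) m ∎
  where open ≡-Reasoning

term≤sumBelow : ∀ (g : ℕ → ℕ) n x → x < n → g x ≤ sumBelow g n
term≤sumBelow g (suc n) zero _ = m≤m+n (g 0) _
term≤sumBelow g (suc n) (suc x) (s<s x<n) = ≤-trans (term≤sumBelow (g ∘ suc) n x x<n) (m≤n+m _ (g 0))

sumBelow-positive : ∀ (g : ℕ → ℕ) n → 0 < sumBelow g n → ∃ λ k → k < n × 0 < g k
sumBelow-positive g (suc n) pos with g 0 in g0≡
... | suc _ = 0 , z<s , subst (0 <_) (sym g0≡) z<s
... | zero with sumBelow-positive (g ∘ suc) n pos
...   | k , k<n , gk>0 = suc k , s<s k<n , gk>0

count : (ℕ → Bool) → ℕ → ℕ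
count p = sumBelow (indicator ∘ p)

indicator-mono : ∀ {a b} → (T a → T b) → indicator a ≤ indicator b
indicator-mono {false} _ = z≤n
indicator-mono {true} {true} _ = ≤-refl
indicator-mono {true} {false} a⇒b = ⊥-elim (a⇒b tt)

indicator-< : ∀ {a b} → T b → ¬ T a → indicator a < indicator b
indicator-< {false} {true} _ _ = z<s
indicator-< {true} _ ¬a = ⊥-elim (¬a tt)

indicator-cover : ∀ {a b c d} → (T a → T b ⊎ T c ⊎ T d)
  → indicator a ≤ indicator b + indicator c + indicator d
indicator-cover {false} _ = z≤n
indicator-cover {true} {true} _ = s≤s z≤n
indicator-cover {true} {false} {true} _ = s≤s z≤n
indicator-cover {true} {false} {false} {true} _ = s≤s z≤n
indicator-cover {true} {false} {false} {false} cover with cover tt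
... | inj₁ ()
... | inj₂ (inj₁ ())
... | inj₂ (inj₂ ())

count-none : ∀ (p : ℕ → Bool) n → (∀ k → k < n → ¬ T (p k)) → count p n ≡ 0
count-none p n none = sumBelow-null (indicator ∘ p) n (λ k k<n → indicator-false (none k k<n))
  where
  indicator-false : ∀ {a} → ¬ T a → indicator a ≡ 0
  indicator-false {false} _ = refl
  indicator-false {true} ¬a = ⊥-elim (¬a tt)

count-positive : ∀ (p : ℕ → Bool) n → 0 < count p n → ∃ λ k → k < n × T (p k)
count-positive p n pos with sumBelow-positive (indicator ∘ p) n pos
... | k , k<n , pk>0 = k , k<n , indicator-positive pk>0
  where
  indicator-positive : ∀ {a} → 0 < indicator a → T a
  indicator-positive {true} _ = tt

count-mono : ∀ {p q : ℕ → Bool} n → (∀ k → k < n → T (p k) → T (q k)) → count p n ≤ count q n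
count-mono n p⇒q = sumBelow-mono n (λ k k<n → indicator-mono (p⇒q k k<n))

count-point : ∀ n x → count (_≡ᵇ x) n ≤ 1
count-point zero x = z≤n
count-point (suc n) zero = ≤-reflexive (cong suc (count-none (λ k → suc k ≡ᵇ 0) n (λ _ _ ())))
count-point (suc n) (suc x) = count-point n x

count-cover : ∀ {p q r : ℕ → Bool} n x → (∀ k → k < n → T (p k) → T (q k) ⊎ T (r k) ⊎ k ≡ x)
  → count p n ≤ suc (count q n + count r n)
count-cover {p} {q} {r} n x cover = begin
  count p n
    ≤⟨ sumBelow-mono n (λ k k<n → indicator-cover (point-≡ᵇ ∘ cover k k<n)) ⟩
  sumBelow (λ k → indicator (q k) + indicator (r k) + indicator (k ≡ᵇ x)) n
    ≡⟨ sumBelow-+ _ _ n ⟩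
  sumBelow (λ k → indicator (q k) + indicator (r k)) n + count (_≡ᵇ x) n
    ≡⟨ cong (_+ count (_≡ᵇ x) n) (sumBelow-+ _ _ n) ⟩
  count q n + count r n + count (_≡ᵇ x) n
    ≤⟨ +-monoʳ-≤ (count q n + count r n) (count-point n x) ⟩
  count q n + count r n + 1
    ≡⟨ +-comm _ 1 ⟩
  suc (count q n + count r n) ∎
  where
  open ≤-Reasoning
  point-≡ᵇ : ∀ {k A B} → A ⊎ B ⊎ k ≡ x → A ⊎ B ⊎ T (k ≡ᵇ x)
  point-≡ᵇ (inj₁ a) = inj₁ a
  point-≡ᵇ (inj₂ (inj₁ b)) = inj₂ (inj₁ b)
  point-≡ᵇ {k} (inj₂ (inj₂ k≡x)) = inj₂ (inj₂ (≡⇒≡ᵇ k x k≡x))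

count-mono-<₂ : ∀ {p q : ℕ → Bool} n x y → (∀ k → k < n → T (p k) → T (q k))
  → x < n → y < n → x ≢ y → T (q x) → T (q y) → ¬ T (p x) → ¬ T (p y)
  → 2 + count p n ≤ count q n
count-mono-<₂ n x y p⇒q x<n y<n x≢y qx qy ¬px ¬py =
  sumBelow-mono-<₂ n x y (λ k k<n → indicator-mono (p⇒q k k<n)) x<n y<n x≢y
    (indicator-< qx ¬px) (indicator-< qy ¬py)

discrete-ivt : ∀ {P : ℕ → Set} → Decidable P → ∀ {a b} → a ≤ b → P a → ¬ P b
  → ∃ λ j → j < b × P j × ¬ P (suc j)
discrete-ivt P? {b = zero} z≤n pa ¬pb = ⊥-elim (¬pb pa)
discrete-ivt P? {a} {suc b} a≤1+b pa ¬p1+b with P? b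
... | yes pb = b , n<1+n b , pb , ¬p1+b
... | no ¬pb with m≤n⇒m<n∨m≡n a≤1+b
...   | inj₂ refl = ⊥-elim (¬p1+b pa)
...   | inj₁ (s≤s a≤b) with discrete-ivt P? a≤b pa ¬pb
...     | j , j<b , pj , ¬p1+j = j , m<n⇒m<1+n j<b , pj , ¬p1+j

-- The path of a height sequence

-- buildPath cur (h ∷ hs) is definitionally climb cur h ++ down ∷ buildPath h hs.
climb : ℕ → ℕ → List Step
climb cur h = if cur ≤ᵇ suc h then replicate (suc h ∸ cur) up else replicate (cur ∸ suc h) jump

jumpCount : ℕ → List ℕ → ℕ
jumpCount cur [] = 0
jumpCount cur (h ∷ hs) = (cur ∸ suc h) + jumpCount h hs

finalHeight : ℕ → List ℕ → ℕ
finalHeight cur [] = cur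
finalHeight cur (h ∷ hs) = finalHeight h hs

climb-cases : ∀ cur h → (cur ≤ suc h × climb cur h ≡ replicate (suc h ∸ cur) up)
                      ⊎ (suc h < cur × climb cur h ≡ replicate (cur ∸ suc h) jump)
climb-cases cur h with cur ≤ᵇ suc h in le
... | true = inj₁ (≤ᵇ⇒≤ cur (suc h) (subst T (sym le) tt) , refl)
... | false = inj₂ (≰⇒> (λ cur≤ → subst T le (≤⇒≤ᵇ cur≤)) , refl)

numSteps-++ : ∀ P xs ys → numSteps P (xs ++ ys) ≡ numSteps P xs + numSteps P ys
numSteps-++ P xs ys = trans (cong length (filter-++ (T? ∘ P) xs ys)) (length-++ (filter (T? ∘ P) xs))

numSteps-replicate : ∀ P m s → numSteps P (replicate m s) ≡ (if P s then m else 0)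
numSteps-replicate P zero s with P s
... | true = refl
... | false = refl
numSteps-replicate P (suc m) s with P s | numSteps-replicate P m s
... | true | ih = cong suc ih
... | false | ih = ih

climb-counts : ∀ cur h → numSteps isUp (climb cur h) ≡ suc h ∸ cur
                       × numSteps isDown (climb cur h) ≡ 0
                       × numSteps isJump (climb cur h) ≡ cur ∸ suc h
climb-counts cur h with climb-cases cur h
... | inj₁ (cur≤ , e) rewrite e =
  numSteps-replicate isUp (suc h ∸ cur) up , numSteps-replicate isDown (suc h ∸ cur) up ,
  trans (numSteps-replicate isJump (suc h ∸ cur) up) (sym (m≤n⇒m∸n≡0 cur≤))
... | inj₂ (<cur , e) rewrite e =
  trans (numSteps-replicate isUp (cur ∸ suc h) jump) (sym (m≤n⇒m∸n≡0 (<⇒≤ <cur))) ,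
  numSteps-replicate isDown (cur ∸ suc h) jump , numSteps-replicate isJump (cur ∸ suc h) jump

m∸n+n≡m+[n∸m] : ∀ m n → m ∸ n + n ≡ m + (n ∸ m)
m∸n+n≡m+[n∸m] m n with ≤-total n m
... | inj₁ n≤m rewrite m≤n⇒m∸n≡0 n≤m = trans (m∸n+n≡m n≤m) (sym (+-identityʳ m))
... | inj₂ m≤n rewrite m≤n⇒m∸n≡0 m≤n = sym (m+[n∸m]≡n m≤n)

buildPath-downs : ∀ cur hs → numSteps isDown (buildPath cur hs) ≡ length hs
buildPath-downs cur [] = refl
buildPath-downs cur (h ∷ hs) =
  let _ , climb-downs , _ = climb-counts cur h in
  trans (numSteps-++ isDown (climb cur h) (down ∷ buildPath h hs))
        (cong₂ _+_ climb-downs (cong suc (buildPath-downs h hs)))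

buildPath-jumps : ∀ cur hs → numSteps isJump (buildPath cur hs) ≡ jumpCount cur hs
buildPath-jumps cur [] = refl
buildPath-jumps cur (h ∷ hs) =
  let _ , _ , climb-jumps = climb-counts cur h in
  trans (numSteps-++ isJump (climb cur h) (down ∷ buildPath h hs))
        (cong₂ _+_ climb-jumps (buildPath-jumps h hs))

buildPath-ups : ∀ cur hs
  → numSteps isUp (buildPath cur hs) + cur ≡ length hs + jumpCount cur hs + finalHeight cur hs
buildPath-ups cur [] = refl
buildPath-ups cur (h ∷ hs) = begin
  numSteps isUp (climb cur h ++ down ∷ buildPath h hs) + cur
    ≡⟨ cong (_+ cur) (numSteps-++ isUp (climb cur h) (down ∷ buildPath h hs)) ⟩
  u + U + cur
    ≡⟨ solve 3 (λ u U c → u :+ U :+ c := u :+ c :+ U) refl u U cur ⟩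
  u + cur + U
    ≡⟨ cong (λ x → x + cur + U) climb-ups ⟩
  (suc h ∸ cur) + cur + U
    ≡⟨ cong (_+ U) (m∸n+n≡m+[n∸m] (suc h) cur) ⟩
  suc h + j + U
    ≡⟨ solve 3 (λ h j U → con 1 :+ h :+ j :+ U := con 1 :+ (j :+ (U :+ h))) refl h j U ⟩
  suc (j + (U + h))
    ≡⟨ cong (λ x → suc (j + x)) (buildPath-ups h hs) ⟩
  suc (j + (L + J + F))
    ≡⟨ solve 4 (λ j L J F → con 1 :+ (j :+ (L :+ J :+ F)) := con 1 :+ L :+ (j :+ J) :+ F)
               refl j L J F ⟩
  suc L + (j + J) + F ∎
  where
  open ≡-Reasoning
  open +-*-Solver
  u U j L J F : ℕ
  u = numSteps isUp (climb cur h)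
  U = numSteps isUp (buildPath h hs)
  j = cur ∸ suc h
  L = length hs
  J = jumpCount h hs
  F = finalHeight h hs
  climb-ups : u ≡ suc h ∸ cur
  climb-ups = let ups , _ = climb-counts cur h in ups

neverBelow-ups : ∀ m c p → NeverBelow (m + c) p → NeverBelow c (replicate m up ++ p)
neverBelow-ups zero c p nb = nb
neverBelow-ups (suc m) c p nb =
  neverBelow-ups m (suc c) p (subst (λ x → NeverBelow x p) (sym (+-suc m c)) nb)

neverBelow-jumps : ∀ m c p → NeverBelow c p → NeverBelow (m + c) (replicate m jump ++ p)
neverBelow-jumps zero c p nb = nb
neverBelow-jumps (suc m) c p nb = neverBelow-jumps m c p nb

buildPath-neverBelow : ∀ cur hs → NeverBelow cur (buildPath cur hs)
buildPath-neverBelow cur [] = tt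
buildPath-neverBelow cur (h ∷ hs) with climb-cases cur h
... | inj₁ (cur≤ , e) rewrite e =
  neverBelow-ups (suc h ∸ cur) cur _
    (subst (λ x → NeverBelow x (down ∷ buildPath h hs)) (sym (m∸n+n≡m cur≤))
      (buildPath-neverBelow h hs))
... | inj₂ (<cur , e) rewrite e =
  subst (λ x → NeverBelow x (replicate (cur ∸ suc h) jump ++ down ∷ buildPath h hs))
    (m∸n+n≡m (<⇒≤ <cur))
    (neverBelow-jumps (cur ∸ suc h) (suc h) _ (buildPath-neverBelow h hs))

buildPath-InD : ∀ hs → finalHeight 0 hs ≡ 0 → InD (length hs) (jumpCount 0 hs) (buildPath 0 hs)
buildPath-InD hs final≡0 = ups , buildPath-downs 0 hs , buildPath-jumps 0 hs , buildPath-neverBelow 0 hs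
  where
  open ≡-Reasoning
  ups : numSteps isUp (buildPath 0 hs) ≡ length hs + jumpCount 0 hs
  ups = begin
    numSteps isUp (buildPath 0 hs)                      ≡⟨ sym (+-identityʳ _) ⟩
    numSteps isUp (buildPath 0 hs) + 0                  ≡⟨ buildPath-ups 0 hs ⟩
    length hs + jumpCount 0 hs + finalHeight 0 hs       ≡⟨ cong (length hs + jumpCount 0 hs +_) final≡0 ⟩
    length hs + jumpCount 0 hs + 0                      ≡⟨ +-identityʳ _ ⟩
    length hs + jumpCount 0 hs                          ∎

-- The down-jumps in front of the down-step of position b; none for b = 0, since the
-- path starts on the axis.
jumpAt : (ℕ → ℕ) → ℕ → ℕ
jumpAt H zero = 0
jumpAt H (suc j) = H j ∸ suc (H (suc j))

jumpCount-applyUpTo : ∀ H n → jumpCount 0 (applyUpTo H n) ≡ sumBelow (jumpAt H) n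
jumpCount-applyUpTo H zero = refl
jumpCount-applyUpTo H (suc n) = from-H0 H n
  where
  from-H0 : ∀ H n → jumpCount (H 0) (applyUpTo (H ∘ suc) n) ≡ sumBelow (jumpAt H ∘ suc) n
  from-H0 H zero = refl
  from-H0 H (suc n) = cong (H 0 ∸ suc (H 1) +_) (from-H0 (H ∘ suc) n)

finalHeight-applyUpTo : ∀ cur H n → finalHeight cur (applyUpTo H (suc n)) ≡ H n
finalHeight-applyUpTo cur H zero = refl
finalHeight-applyUpTo cur H (suc n) = finalHeight-applyUpTo (H 0) (H ∘ suc) n

finalHeight-applyUpTo-null : ∀ H n → (∀ i → n ≤ suc i → H i ≡ 0) → finalHeight 0 (applyUpTo H n) ≡ 0
finalHeight-applyUpTo-null H zero _ = refl
finalHeight-applyUpTo-null H (suc n) null = trans (finalHeight-applyUpTo 0 H n) (null n ≤-refl)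

-- Heights and occurrences of a permutation

InOrder : Pattern → ℕ → ℕ → ℕ → Set
InOrder p312 x y z = y < z × z < x
InOrder p321 x y z = z < y × y < x

inOrder⁺ : ∀ τ {x y z} → InOrder τ x y z → T (inOrder τ x y z)
inOrder⁺ p312 (y<z , z<x) = Equivalence.from T-∧ (<⇒<ᵇ y<z , <⇒<ᵇ z<x)
inOrder⁺ p321 (z<y , y<x) = Equivalence.from T-∧ (<⇒<ᵇ z<y , <⇒<ᵇ y<x)

inOrder⁻ : ∀ τ {x y z} → T (inOrder τ x y z) → InOrder τ x y z
inOrder⁻ p312 {x} {y} {z} t =
  let y<z , z<x = Equivalence.to (T-∧ {y <ᵇ z}) t in <ᵇ⇒< y z y<z , <ᵇ⇒< z x z<x
inOrder⁻ p321 {x} {y} {z} t =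
  let z<y , y<x = Equivalence.to (T-∧ {z <ᵇ y}) t in <ᵇ⇒< z y z<y , <ᵇ⇒< y x y<x

module _ {n : ℕ} (ρ : Permutation′ n) where

  private
    f : ℕ → ℕ
    f = val ρ

    LR : ℕ → Bool
    LR = isLRmax ρ

    prec : ℕ → ℕ
    prec = precLRmax ρ

  val-lookup : ∀ {i} (i<n : i < n) → f i ≡ toℕ (ρ ⟨$⟩ʳ fromℕ< i<n)
  val-lookup {i} i<n with i <? n
  ... | yes _ = refl
  ... | no i≮n = ⊥-elim (i≮n i<n)

  val-injective : ∀ {i j} → i < n → j < n → f i ≡ f j → i ≡ j
  val-injective {i} {j} i<n j<n fi≡fj = fromℕ<-injective i j i<n j<n
    (Injection.injective (↔⇒↣ ρ)
      (toℕ-injective (trans (sym (val-lookup i<n)) (trans fi≡fj (val-lookup j<n)))))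

  val-<⊎> : ∀ {i j} → i < n → j < n → i ≢ j → f i < f j ⊎ f j < f i
  val-<⊎> {i} {j} i<n j<n i≢j with <-cmp (f i) (f j)
  ... | tri< fi<fj _ _ = inj₁ fi<fj
  ... | tri≈ _ fi≡fj _ = ⊥-elim (i≢j (val-injective i<n j<n fi≡fj))
  ... | tri> _ _ fj<fi = inj₂ fj<fi

  LR-sound : ∀ {i j} → T (LR i) → j < i → f j < f i
  LR-sound {i} lr j<i = <ᵇ⇒< _ _ (lookup (all⁺ (λ j → f j <ᵇ f i) (upTo i) lr) (∈-upTo⁺ j<i))

  LR-witness : ∀ {i} → ¬ T (LR i) → ∃ λ j → j < i × f i ≤ f j
  LR-witness {i} ¬lr with find (¬All⇒Any¬ (λ j → T? (f j <ᵇ f i)) (upTo i) (¬lr ∘ all⁻ _))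
  ... | j , j∈ , fj≮fi = j , ∈-upTo⁻ j∈ , ≮⇒≥ (fj≮fi ∘ <⇒<ᵇ)

  prec-LR : ∀ {i} → T (LR i) → prec i ≡ i
  prec-LR {zero} _ = refl
  prec-LR {suc i} lr with LR (suc i)
  ... | true = refl

  prec-nonLR : ∀ {i} → ¬ T (LR (suc i)) → prec (suc i) ≡ prec i
  prec-nonLR {i} ¬lr with LR (suc i)
  ... | true = ⊥-elim (¬lr tt)
  ... | false = refl

  prec≤ : ∀ i → prec i ≤ i
  prec≤ zero = z≤n
  prec≤ (suc i) with LR (suc i)
  ... | true = ≤-refl
  ... | false = m≤n⇒m≤1+n (prec≤ i)

  prec-isLR : ∀ i → T (LR (prec i))
  prec-isLR zero = tt
  prec-isLR (suc i) with LR (suc i) in lr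
  ... | true = subst T (sym lr) tt
  ... | false = prec-isLR i

  prec-max : ∀ i j → j ≤ i → f j ≤ f (prec i)
  prec-max zero zero z≤n = ≤-refl
  prec-max (suc i) j j≤1+i with LR (suc i) in lr | m≤n⇒m<n∨m≡n j≤1+i
  ... | true | inj₁ j<1+i = <⇒≤ (LR-sound (subst T (sym lr) tt) j<1+i)
  ... | true | inj₂ refl = ≤-refl
  ... | false | inj₁ (s≤s j≤i) = prec-max i j j≤i
  ... | false | inj₂ refl with LR-witness {suc i} (λ t → subst T lr t)
  ...   | k , s≤s k≤i , fi≤fk = ≤-trans fi≤fk (prec-max i k k≤i)

  below-prec : ∀ {i} → i < n → ¬ T (LR i) → f i < f (prec i)
  below-prec {i} i<n ¬lr = ≤∧≢⇒< (prec-max i i ≤-refl) (¬lr ∘ LR-at-prec)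
    where
    LR-at-prec : f i ≡ f (prec i) → T (LR i)
    LR-at-prec fi≡fr =
      subst (T ∘ LR) (sym (val-injective i<n (≤-<-trans (prec≤ i) i<n) fi≡fr)) (prec-isLR i)

  -- Opaque so that their arguments can be inferred from goals T (laterBelow j v k);
  -- the next block identifies them with the Boolean expressions used in Defs.
  opaque
    laterBelow : ℕ → ℕ → ℕ → Bool
    laterBelow j v k = (j <ᵇ k) ∧ (f k <ᵇ v)

    laterBetween : ℕ → ℕ → ℕ → ℕ → Bool
    laterBetween j u v k = (j <ᵇ k) ∧ ((u <ᵇ f k) ∧ (f k <ᵇ v))

    occurs : Pattern → ℕ → ℕ → ℕ → Bool
    occurs τ a b c = (a <ᵇ b) ∧ (b <ᵇ c) ∧ inOrder τ (f a) (f b) (f c)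

  occurrencesAt : Pattern → ℕ → ℕ → ℕ
  occurrencesAt τ a b = count (occurs τ a b) n

  opaque
    unfolding laterBelow laterBetween occurs

    laterBelow⁺ : ∀ {j v k} → j < k → f k < v → T (laterBelow j v k)
    laterBelow⁺ j<k fk<v = Equivalence.from T-∧ (<⇒<ᵇ j<k , <⇒<ᵇ fk<v)

    laterBelow⁻ : ∀ {j v k} → T (laterBelow j v k) → j < k × f k < v
    laterBelow⁻ {j} {v} {k} t =
      let j<k , fk<v = Equivalence.to (T-∧ {j <ᵇ k}) t in <ᵇ⇒< j k j<k , <ᵇ⇒< (f k) v fk<v

    laterBetween⁺ : ∀ {j u v k} → j < k → u < f k → f k < v → T (laterBetween j u v k)
    laterBetween⁺ j<k u<fk fk<v =
      Equivalence.from T-∧ (<⇒<ᵇ j<k , Equivalence.from T-∧ (<⇒<ᵇ u<fk , <⇒<ᵇ fk<v))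

    laterBetween⁻ : ∀ {j u v k} → T (laterBetween j u v k) → j < k × u < f k × f k < v
    laterBetween⁻ {j} {u} {v} {k} t =
      let j<k , inside = Equivalence.to (T-∧ {j <ᵇ k}) t
          u<fk , fk<v = Equivalence.to (T-∧ {u <ᵇ f k}) inside
      in <ᵇ⇒< j k j<k , <ᵇ⇒< u (f k) u<fk , <ᵇ⇒< (f k) v fk<v

    occurs⁺ : ∀ τ {a b c} → a < b → b < c → InOrder τ (f a) (f b) (f c) → T (occurs τ a b c)
    occurs⁺ τ a<b b<c ord =
      Equivalence.from T-∧ (<⇒<ᵇ a<b , Equivalence.from T-∧ (<⇒<ᵇ b<c , inOrder⁺ τ ord))

    occurs⁻ : ∀ τ {a b c} → T (occurs τ a b c) → a < b × b < c × InOrder τ (f a) (f b) (f c)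
    occurs⁻ τ {a} {b} {c} t =
      let a<b , rest = Equivalence.to (T-∧ {a <ᵇ b}) t
          b<c , ord = Equivalence.to (T-∧ {b <ᵇ c}) rest
      in <ᵇ⇒< a b a<b , <ᵇ⇒< b c b<c , inOrder⁻ τ ord

    occurrences-as-sum : ∀ τ → occurrences τ ρ ≡ sumBelow (λ a → sumBelow (occurrencesAt τ a) n) n
    occurrences-as-sum τ =
      trans (sum-upTo _ n) (sumBelow-cong n (λ a _ →
        trans (sum-upTo _ n) (sumBelow-cong n (λ b _ → sum-upTo _ n))))


    height312 : ∀ j → height p312 ρ j ≡ count (laterBelow j (f j)) n
    height312 j = sum-upTo _ n

    height321-LR : ∀ {j} → T (LR j) → height p321 ρ j ≡ count (laterBelow j (f j)) n
    height321-LR {j} lr with LR j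
    ... | true = sum-upTo _ n

    height321-nonLR : ∀ {j} → ¬ T (LR j) → height p321 ρ j ≡ count (laterBetween j (f j) (f (prec j))) n
    height321-nonLR {j} ¬lr with LR j
    ... | true = ⊥-elim (¬lr tt)
    ... | false = sum-upTo _ n

  occurrence-witness : ∀ τ → 0 < occurrences τ ρ
    → ∃ λ a → ∃ λ b → ∃ λ c → c < n × a < b × b < c × InOrder τ (f a) (f b) (f c)
  occurrence-witness τ pos with sumBelow-positive _ n (subst (0 <_) (occurrences-as-sum τ) pos)
  ... | a , _ , pos-a with sumBelow-positive _ n pos-a
  ... | b , _ , pos-ab with count-positive (occurs τ a b) n pos-ab
  ... | c , c<n , occ = a , b , c , c<n , occurs⁻ τ occ

  height321≤ : ∀ j → height p321 ρ j ≤ count (laterBelow j (f (prec j))) n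
  height321≤ j with T? (LR j)
  ... | yes lr =
    ≤-reflexive (trans (height321-LR lr) (cong (λ r → count (laterBelow j (f r)) n) (sym (prec-LR lr))))
  ... | no ¬lr = ≤-trans (≤-reflexive (height321-nonLR ¬lr))
    (count-mono n (λ k _ t → let j<k , _ , fk<v = laterBetween⁻ t in laterBelow⁺ j<k fk<v))

  countAfter-last : ∀ i P → n ≤ suc i → countAfter ρ i P ≡ 0
  countAfter-last i P n≤1+i = trans (sum-upTo _ n) (count-none _ n after-last)
    where
    after-last : ∀ k → k < n → ¬ T ((i <ᵇ k) ∧ P (f k))
    after-last k k<n t =
      <⇒≱ (<ᵇ⇒< i k (proj₁ (Equivalence.to (T-∧ {i <ᵇ k}) t))) (s≤s⁻¹ (≤-trans k<n n≤1+i))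

  height-last : ∀ τ i → n ≤ suc i → height τ ρ i ≡ 0
  height-last p312 i = countAfter-last i (_<ᵇ f i)
  height-last p321 i with isLRmax ρ i
  ... | true = countAfter-last i (_<ᵇ f i)
  ... | false = countAfter-last i (λ x → (f i <ᵇ x) ∧ (x <ᵇ f (prec i)))

  height312-step : ∀ j → suc j < n
    → height p312 ρ j ≤ suc (height p312 ρ (suc j) + occurrencesAt p312 j (suc j))
  height312-step j 1+j<n rewrite height312 j | height312 (suc j) = count-cover n (suc j) cover
    where
    cover : ∀ k → k < n → T (laterBelow j (f j) k)
      → T (laterBelow (suc j) (f (suc j)) k) ⊎ T (occurs p312 j (suc j) k) ⊎ k ≡ suc j
    cover k k<n t with laterBelow⁻ t
    ... | j<k , fk<fj with m≤n⇒m<n∨m≡n j<k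
    ...   | inj₂ 1+j≡k = inj₂ (inj₂ (sym 1+j≡k))
    ...   | inj₁ 1+j<k with val-<⊎> k<n 1+j<n (>⇒≢ 1+j<k)
    ...     | inj₁ fk<f1+j = inj₁ (laterBelow⁺ 1+j<k fk<f1+j)
    ...     | inj₂ f1+j<fk = inj₂ (inj₁ (occurs⁺ p312 (n<1+n j) 1+j<k (f1+j<fk , fk<fj)))

  height321-step : ∀ j → suc j < n
    → height p321 ρ j ≤ suc (height p321 ρ (suc j) + occurrencesAt p321 (prec j) (suc j))
  height321-step j 1+j<n = ≤-trans (height321≤ j) (step (T? (LR (suc j))))
    where
    step : Dec (T (LR (suc j))) → count (laterBelow j (f (prec j))) n
      ≤ suc (height p321 ρ (suc j) + occurrencesAt p321 (prec j) (suc j))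
    step (yes lr) rewrite height321-LR lr = count-cover n (suc j) cover
      where
      cover : ∀ k → k < n → T (laterBelow j (f (prec j)) k)
        → T (laterBelow (suc j) (f (suc j)) k) ⊎ T (occurs p321 (prec j) (suc j) k) ⊎ k ≡ suc j
      cover k k<n t with laterBelow⁻ t
      ... | j<k , fk<fr with m≤n⇒m<n∨m≡n j<k
      ...   | inj₂ 1+j≡k = inj₂ (inj₂ (sym 1+j≡k))
      ...   | inj₁ 1+j<k = inj₁ (laterBelow⁺ 1+j<k (<-trans fk<fr (LR-sound lr (s≤s (prec≤ j)))))
    step (no ¬lr) rewrite height321-nonLR ¬lr = count-cover n (suc j) cover
      where
      prec-1+j : prec (suc j) ≡ prec j
      prec-1+j = prec-nonLR ¬lr
      f1+j<fr : f (suc j) < f (prec j)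
      f1+j<fr = subst (λ r → f (suc j) < f r) prec-1+j (below-prec 1+j<n ¬lr)
      cover : ∀ k → k < n → T (laterBelow j (f (prec j)) k)
        → T (laterBetween (suc j) (f (suc j)) (f (prec (suc j))) k) ⊎ T (occurs p321 (prec j) (suc j) k)
          ⊎ k ≡ suc j
      cover k k<n t with laterBelow⁻ t
      ... | j<k , fk<fr with m≤n⇒m<n∨m≡n j<k
      ...   | inj₂ 1+j≡k = inj₂ (inj₂ (sym 1+j≡k))
      ...   | inj₁ 1+j<k with val-<⊎> k<n 1+j<n (>⇒≢ 1+j<k)
      ...     | inj₁ fk<f1+j = inj₂ (inj₁ (occurs⁺ p321 (s≤s (prec≤ j)) 1+j<k (fk<f1+j , f1+j<fr)))
      ...     | inj₂ f1+j<fk =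
        inj₁ (laterBetween⁺ 1+j<k f1+j<fk (subst (λ r → f k < f r) (sym prec-1+j) fk<fr))

  jumpAt≤occurrencesAt : ∀ τ b → b < n → jumpAt (height τ ρ) b ≤ sumBelow (λ a → occurrencesAt τ a b) n
  jumpAt≤occurrencesAt τ zero _ = z≤n
  jumpAt≤occurrencesAt p312 (suc j) 1+j<n =
    ≤-trans (m≤n+o⇒m∸n≤o _ _ (height312-step j 1+j<n))
            (term≤sumBelow _ n j (<-trans (n<1+n j) 1+j<n))
  jumpAt≤occurrencesAt p321 (suc j) 1+j<n =
    ≤-trans (m≤n+o⇒m∸n≤o _ _ (height321-step j 1+j<n))
            (term≤sumBelow _ n (prec j) (≤-<-trans (prec≤ j) (<-trans (n<1+n j) 1+j<n)))

  height312-drop : ∀ {j c} → suc j < c → c < n → f (suc j) < f c → f c < f j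
    → 2 + height p312 ρ (suc j) ≤ height p312 ρ j
  height312-drop {j} {c} 1+j<c c<n f1+j<fc fc<fj =
    subst₂ (λ h′ h → 2 + h′ ≤ h) (sym (height312 (suc j))) (sym (height312 j)) $
    count-mono-<₂ n (suc j) c later⇒later (<-trans 1+j<c c<n) c<n (<⇒≢ 1+j<c)
      (laterBelow⁺ (n<1+n j) (<-trans f1+j<fc fc<fj)) (laterBelow⁺ (<-trans (n<1+n j) 1+j<c) fc<fj)
      (λ t → n≮n (suc j) (proj₁ (laterBelow⁻ t)))
      (λ t → <-asym f1+j<fc (proj₂ (laterBelow⁻ t)))
    where
    later⇒later : ∀ k → k < n → T (laterBelow (suc j) (f (suc j)) k) → T (laterBelow j (f j) k)
    later⇒later k _ t = let 1+j<k , fk<f1+j = laterBelow⁻ t in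
      laterBelow⁺ (<-trans (n<1+n j) 1+j<k) (<-trans fk<f1+j (<-trans f1+j<fc fc<fj))

  height321-drop-LR : ∀ {j w} → T (LR j) → ¬ T (LR (suc j)) → suc j < w → w < n → f w < f (suc j)
    → 2 + height p321 ρ (suc j) ≤ height p321 ρ j
  height321-drop-LR {j} {w} lr ¬lr′ 1+j<w w<n fw<f1+j =
    subst₂ (λ h′ h → 2 + h′ ≤ h) (sym (height321-nonLR ¬lr′)) (sym (height321-LR lr)) $
    count-mono-<₂ n (suc j) w later⇒later (<-trans 1+j<w w<n) w<n (<⇒≢ 1+j<w)
      (laterBelow⁺ (n<1+n j) f1+j<fj) (laterBelow⁺ (<-trans (n<1+n j) 1+j<w) (<-trans fw<f1+j f1+j<fj))
      (λ t → n≮n (suc j) (proj₁ (laterBetween⁻ t)))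
      (λ t → <-asym fw<f1+j (proj₁ (proj₂ (laterBetween⁻ t))))
    where
    prec-1+j : prec (suc j) ≡ j
    prec-1+j = trans (prec-nonLR ¬lr′) (prec-LR lr)
    f1+j<fj : f (suc j) < f j
    f1+j<fj = subst (λ r → f (suc j) < f r) prec-1+j (below-prec (<-trans 1+j<w w<n) ¬lr′)
    later⇒later : ∀ k → k < n → T (laterBetween (suc j) (f (suc j)) (f (prec (suc j))) k)
      → T (laterBelow j (f j) k)
    later⇒later k _ t = let 1+j<k , _ , fk<fr = laterBetween⁻ t in
      laterBelow⁺ (<-trans (n<1+n j) 1+j<k) (subst (λ r → f k < f r) prec-1+j fk<fr)

  height321-drop-nonLR : ∀ {j w} → ¬ T (LR j) → ¬ T (LR (suc j)) → suc j < w → w < n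
    → f j < f w → f w < f (suc j) → 2 + height p321 ρ (suc j) ≤ height p321 ρ j
  height321-drop-nonLR {j} {w} ¬lr ¬lr′ 1+j<w w<n fj<fw fw<f1+j =
    subst₂ (λ h′ h → 2 + h′ ≤ h) (sym (height321-nonLR ¬lr′)) (sym (height321-nonLR ¬lr)) $
    count-mono-<₂ n (suc j) w later⇒later (<-trans 1+j<w w<n) w<n (<⇒≢ 1+j<w)
      (laterBetween⁺ (n<1+n j) (<-trans fj<fw fw<f1+j) f1+j<fr)
      (laterBetween⁺ (<-trans (n<1+n j) 1+j<w) fj<fw (<-trans fw<f1+j f1+j<fr))
      (λ t → n≮n (suc j) (proj₁ (laterBetween⁻ t)))
      (λ t → <-asym fw<f1+j (proj₁ (proj₂ (laterBetween⁻ t))))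
    where
    prec-1+j : prec (suc j) ≡ prec j
    prec-1+j = prec-nonLR ¬lr′
    f1+j<fr : f (suc j) < f (prec j)
    f1+j<fr = subst (λ r → f (suc j) < f r) prec-1+j (below-prec (<-trans 1+j<w w<n) ¬lr′)
    later⇒later : ∀ k → k < n → T (laterBetween (suc j) (f (suc j)) (f (prec (suc j))) k)
      → T (laterBetween j (f j) (f (prec j)) k)
    later⇒later k _ t = let 1+j<k , f1+j<fk , fk<fr = laterBetween⁻ t in
      laterBetween⁺ (<-trans (n<1+n j) 1+j<k) (<-trans fj<fw (<-trans fw<f1+j f1+j<fk))
        (subst (λ r → f k < f r) prec-1+j fk<fr)

  HeightDrop : Pattern → Set
  HeightDrop τ = ∃ λ j → suc j < n × 2 + height τ ρ (suc j) ≤ height τ ρ j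

  occurrence312⇒HeightDrop : ∀ {a b c} → a < b → b < c → c < n → f b < f c → f c < f a → HeightDrop p312
  occurrence312⇒HeightDrop {a} {b} {c} a<b b<c c<n fb<fc fc<fa
    with discrete-ivt (λ j → f c <? f j) (<⇒≤ a<b) fc<fa (<-asym fb<fc)
  ... | j , j<b , fc<fj , fc≮f1+j = j , <-trans 1+j<c c<n , height312-drop 1+j<c c<n f1+j<fc fc<fj
    where
    1+j<c : suc j < c
    1+j<c = ≤-<-trans j<b b<c
    f1+j<fc : f (suc j) < f c
    f1+j<fc = [ id , ⊥-elim ∘ fc≮f1+j ]′ (val-<⊎> (<-trans 1+j<c c<n) c<n (<⇒≢ 1+j<c))

  occurrence321⇒HeightDrop : ∀ {a b c} → a < b → b < c → c < n → f c < f b → f b < f a → HeightDrop p321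
  occurrence321⇒HeightDrop {a} {b} {c} a<b b<c c<n fc<fb fb<fa
    with discrete-ivt (λ j → T? (LR j) ⊎-dec (f j <? f c)) z≤n (inj₁ tt) [ ¬lr-b , <-asym fc<fb ]′
    where
    ¬lr-b : ¬ T (LR b)
    ¬lr-b lr = <-asym (LR-sound lr a<b) fb<fa
  ... | j , j<b , lr⊎fj<fc , ¬q = j , <-trans 1+j<c c<n , drop (T? (LR j)) lr⊎fj<fc
    where
    1+j<c : suc j < c
    1+j<c = ≤-<-trans j<b b<c
    fc<f1+j : f c < f (suc j)
    fc<f1+j = [ ⊥-elim ∘ ¬q ∘ inj₂ , id ]′ (val-<⊎> (<-trans 1+j<c c<n) c<n (<⇒≢ 1+j<c))
    drop : Dec (T (LR j)) → T (LR j) ⊎ f j < f c → 2 + height p321 ρ (suc j) ≤ height p321 ρ j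
    drop (yes lr) _ = height321-drop-LR lr (¬q ∘ inj₁) 1+j<c c<n fc<f1+j
    drop (no ¬lr) (inj₁ lr) = ⊥-elim (¬lr lr)
    drop (no ¬lr) (inj₂ fj<fc) = height321-drop-nonLR ¬lr (¬q ∘ inj₁) 1+j<c c<n fj<fc fc<f1+j

  occurrence⇒HeightDrop : ∀ τ → 0 < occurrences τ ρ → HeightDrop τ
  occurrence⇒HeightDrop p312 pos with occurrence-witness p312 pos
  ... | a , b , c , c<n , a<b , b<c , fb<fc , fc<fa = occurrence312⇒HeightDrop a<b b<c c<n fb<fc fc<fa
  occurrence⇒HeightDrop p321 pos with occurrence-witness p321 pos
  ... | a , b , c , c<n , a<b , b<c , fc<fb , fb<fa = occurrence321⇒HeightDrop a<b b<c c<n fc<fb fb<fa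

  heights : Pattern → List ℕ
  heights τ = applyUpTo (height τ ρ) n

  ψ-InD : ∀ τ → InD n (jumpCount 0 (heights τ)) (ψ τ ρ)
  ψ-InD τ =
    subst₂ (λ m p → InD m (jumpCount 0 (heights τ)) p)
      (length-applyUpTo (height τ ρ) n) (sym (cong (buildPath 0) (map-upTo (height τ ρ) n)))
      (buildPath-InD (heights τ) (finalHeight-applyUpTo-null (height τ ρ) n (height-last τ)))

  jumps-positive : ∀ τ → 0 < occurrences τ ρ → 0 < jumpCount 0 (heights τ)
  jumps-positive τ pos with occurrence⇒HeightDrop τ pos
  ... | j , 1+j<n , drop =
    subst (0 <_) (sym (jumpCount-applyUpTo (height τ ρ) n))
      (≤-trans (m<n⇒0<n∸m drop) (term≤sumBelow (jumpAt (height τ ρ)) n (suc j) 1+j<n))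

  jumps≤occurrences : ∀ τ → jumpCount 0 (heights τ) ≤ occurrences τ ρ
  jumps≤occurrences τ = begin
    jumpCount 0 (heights τ)                                   ≡⟨ jumpCount-applyUpTo (height τ ρ) n ⟩
    sumBelow (jumpAt (height τ ρ)) n                          ≤⟨ sumBelow-mono n (jumpAt≤occurrencesAt τ) ⟩
    sumBelow (λ b → sumBelow (λ a → occurrencesAt τ a b) n) n ≡⟨ sumBelow-swap (occurrencesAt τ) n n ⟨
    sumBelow (λ a → sumBelow (occurrencesAt τ a) n) n         ≡⟨ occurrences-as-sum τ ⟨
    occurrences τ ρ                                           ∎
    where open ≤-Reasoning

mainTheorem2 : (r : ℕ) → 0 < r → (τ : Pattern) → (n : ℕ) → (ρ : Permutation′ n)
    → occurrences τ ρ ≡ r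
    → ∃ λ s → (1 ≤ s) × (s ≤ r) × InD n s (ψ τ ρ)
mainTheorem2 r 0<r τ n ρ occurrences≡r =
  jumpCount 0 (heights ρ τ) ,
  jumps-positive ρ τ (subst (0 <_) (sym occurrences≡r) 0<r) ,
  subst (jumpCount 0 (heights ρ τ) ≤_) occurrences≡r (jumps≤occurrences ρ τ) ,
  ψ-InD ρ τ
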